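{- Let $n,d,e,u,g$ be non-negative integers with $g<u\le d\le n-(d+g+1)$. Suppose $M$ and $M'$ are $m\times n$ Boolean matrices, where $M$ is $(d,e;u,g)$-disjunct and $M'$ is strongly $(2d,e;u)$-disjunct. Then $M$ is strongly $(d,e;g+1)$-disjunct and $M'$ is $(d,e;u,g)$-disjunct.
   Context: For a column $C$ of a Boolean matrix, $\mathrm{supp}(C)$ is the set of row indices where $C$ is $1$. A matrix with at least $d+v$ columns is strongly $(d,e;v)$-disjunct if for every choice of $d+v$ distinct columns $C_1,\dots,C_v,C'_1,\dots,C'_d$, $|\bigcap_{i=1}^v\mathrm{supp}(C_i)\setminus\bigcup_{i=1}^d\mathrm{supp}(C'_i)|>e$. A row of an $m\times n$ matrix $A$ $u$-satisfies disjoint sets $S,Z\subseteq[n]$ if, restricted to the columns in $S$, it has exactly $u$ ones and, restricted to $Z$, no ones. $A$ is $(d,e;u,g)$-disjunct if for all $S,Z\subseteq[n]$ with $u\le|S|\le d$, $|Z|\le|S|$, $S\cap Z=\emptyset$, and every $I\subseteq S$ with $|I|=g+1$, more than $e$ rows of $A$ $u$-satisfy $S$ and $Z$ and have all ones in the columns of $I$. -}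

module Defs where

open import Data.Nat using (ℕ; _+_; _≤_; _<_; _>_; suc)
open import Data.Bool using (Bool)
open import Data.Fin using (Fin; _↑ˡ_; _↑ʳ_)
open import Data.Fin.Subset using (Subset; ∣_∣; _⊆_; _∩_; _∪_; ∁; ⊤; ⊥; Empty)
open import Data.Vec using (tabulate)
open import Data.Vec.Functional using (foldr)
open import Data.Product using (_×_)
open import Relation.Binary.PropositionalEquality using (_≡_)
open import Function.Definitions using (Injective)

Matrix : ℕ → ℕ → Set
Matrix m n = Fin m → Fin n → Bool

supp : ∀ {m n} → Matrix m n → Fin n → Subset m
supp M j = tabulate λ i → M i j

rowSupp : ∀ {m n} → Matrix m n → Fin m → Subset n
rowSupp M i = tabulate λ j → M i j

-- Intersection / union of a finite indexed family of subsets
-- (empty intersection = all rows, empty union = no rows).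
⋂ : ∀ {k m} → (Fin k → Subset m) → Subset m
⋂ = foldr _∩_ ⊤

⋃ : ∀ {k m} → (Fin k → Subset m) → Subset m
⋃ = foldr _∪_ ⊥

-- Strongly (d,e;v)-disjunct: at least d+v columns, and for every choice of
-- d+v distinct columns C_1..C_v, C'_1..C'_d (an injective map
-- Fin (v + d) → Fin n; the first v are the C_i, the last d the C'_i),
-- |⋂ supp C_i \ ⋃ supp C'_i| > e.
StronglyDisjunct : ∀ {m n} → ℕ → ℕ → ℕ → Matrix m n → Set
StronglyDisjunct {m} {n} d e v M =
  (d + v ≤ n) ×
  ((cols : Fin (v + d) → Fin n) → Injective _≡_ _≡_ cols →
    ∣ ⋂ (λ (i : Fin v) → supp M (cols (i ↑ˡ d)))
        ∩ ∁ (⋃ (λ (i : Fin d) → supp M (cols (v ↑ʳ i)))) ∣ > e)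

-- The set of rows of M that u-satisfy S and Z (exactly u ones in the
-- columns S, no ones in the columns Z) and have all ones in the columns I.
goodRows : ∀ {m n} → ℕ → Matrix m n → (S Z I : Subset n) → Subset m
goodRows u M S Z I = tabulate λ r →
  isYes ((∣ rowSupp M r ∩ S ∣ Data.Nat.≟ u)
         ×-dec (∣ rowSupp M r ∩ Z ∣ Data.Nat.≟ 0)
         ×-dec (I ⊆? rowSupp M r))
  where
  open import Relation.Nullary.Decidable using (isYes; _×-dec_)
  open import Data.Fin.Subset.Properties using (_⊆?_)
  import Data.Nat

Disjunct : ∀ {m n} → ℕ → ℕ → ℕ → ℕ → Matrix m n → Set
Disjunct {m} {n} d e u g M =
  (S Z : Subset n) → u ≤ ∣ S ∣ → ∣ S ∣ ≤ d → ∣ Z ∣ ≤ ∣ S ∣ →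
  Empty (S ∩ Z) →
  (I : Subset n) → I ⊆ S → ∣ I ∣ ≡ suc g →
  ∣ goodRows u M S Z I ∣ > e

-- For M: given columns C_1..C_{g+1} and C'_1..C'_d, let I = {C_i}, Z = {C'_i}
-- and pad I to a set S of exactly d columns avoiding Z (possible as g + 1 ≤ d
-- and n ≥ 2d). Every row that u-satisfies S and Z and is 1 on I is 1 on all
-- C_i and 0 on all C'_i.
--
-- For M′: given S, Z and I ⊆ S with |I| = g + 1 ≤ u ≤ |S|, pad I to a set
-- U ⊆ S of exactly u columns, and pad (S ∖ U) ∪ Z (at most 2d columns) to a
-- set D of exactly 2d columns avoiding U (possible as n ≥ 2d + u). A row that
-- is 1 on U and 0 on D meets S exactly in U, hence u-satisfies S and Z and is
-- 1 on I.
module Submission where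

open import Defs
open import Data.Nat using (ℕ; zero; suc; _+_; _*_; _≤_; _<_; z≤n; s≤s; _≤?_)
open import Data.Nat.Properties
  using (≤-trans; ≤-reflexive; ≤-antisym; ≰⇒>; n≤1+n; +-suc; +-comm; +-monoʳ-≤; +-mono-≤; m≤n+m; m≤m+n; +-identityʳ; m+n≤o⇒m≤o∸n; module ≤-Reasoning)
open import Data.Bool using (Bool; true)
open import Data.Bool.Properties using (T-≡)
open import Data.Fin using (Fin; zero; suc; _↑ˡ_; _↑ʳ_; splitAt)
open import Data.Fin.Properties
  using (suc-injective; 0≢1+n; ↑ˡ-injective; ↑ʳ-injective; splitAt-↑ˡ; splitAt-↑ʳ; splitAt⁻¹-↑ˡ; splitAt⁻¹-↑ʳ)
open import Data.Fin.Subset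
  using (Subset; inside; outside; _∈_; _∉_; _⊆_; _∩_; _∪_; ∁; ⁅_⁆; ∣_∣; Empty)
open import Data.Fin.Subset.Properties
open import Data.Vec using ([]; _∷_; tabulate; here; there)
open import Data.Vec.Properties using (lookup∘tabulate; []=⇒lookup; lookup⇒[]=)
open import Data.Vec.Functional using (_++_)
open import Data.Vec.Functional.Properties using (lookup-++ˡ; lookup-++ʳ)
open import Data.Product using (Σ-syntax; ∃; _×_; _,_; proj₁; proj₂)
open import Data.Sum using (inj₁; inj₂)
open import Data.Empty using (⊥-elim)
open import Function using (_∘_; Equivalence)
open import Function.Definitions using (Injective)
open import Relation.Nullary using (yes; no)
open import Relation.Nullary.Decidable using (toWitness; fromWitness)
open import Relation.Binary.PropositionalEquality

private
  variable
    k l m n : ℕ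

x∈tabulate⁺ : (f : Fin n → Bool) {x : Fin n} → f x ≡ true → x ∈ tabulate f
x∈tabulate⁺ f {x} fx≡true = lookup⇒[]= x (tabulate f) (trans (lookup∘tabulate f x) fx≡true)

x∈tabulate⁻ : (f : Fin n → Bool) {x : Fin n} → x ∈ tabulate f → f x ≡ true
x∈tabulate⁻ f {x} x∈ = trans (sym (lookup∘tabulate f x)) ([]=⇒lookup x∈)

x∈⋂⁺ : (p : Fin k → Subset n) {x : Fin n} → (∀ i → x ∈ p i) → x ∈ ⋂ p
x∈⋂⁺ {zero}  p x∈p = ∈⊤
x∈⋂⁺ {suc k} p x∈p = x∈p∩q⁺ (x∈p zero , x∈⋂⁺ (p ∘ suc) (x∈p ∘ suc))

x∈⋂⁻ : (p : Fin k → Subset n) {x : Fin n} → x ∈ ⋂ p → ∀ i → x ∈ p i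
x∈⋂⁻ {suc k} p x∈ zero    = proj₁ (x∈p∩q⁻ _ _ x∈)
x∈⋂⁻ {suc k} p x∈ (suc i) = x∈⋂⁻ (p ∘ suc) (proj₂ (x∈p∩q⁻ _ _ x∈)) i

x∈⋃⁺ : (p : Fin k → Subset n) {x : Fin n} (i : Fin k) → x ∈ p i → x ∈ ⋃ p
x∈⋃⁺ {suc k} p zero    x∈ = x∈p∪q⁺ (inj₁ x∈)
x∈⋃⁺ {suc k} p (suc i) x∈ = x∈p∪q⁺ (inj₂ (x∈⋃⁺ (p ∘ suc) i x∈))

x∈⋃⁻ : (p : Fin k → Subset n) {x : Fin n} → x ∈ ⋃ p → ∃ λ i → x ∈ p i
x∈⋃⁻ {zero}  p x∈ = ⊥-elim (∉⊥ x∈)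
x∈⋃⁻ {suc k} p x∈ with x∈p∪q⁻ _ _ x∈
... | inj₁ x∈p₀ = zero , x∈p₀
... | inj₂ x∈ps with x∈⋃⁻ (p ∘ suc) x∈ps
...   | i , x∈pᵢ = suc i , x∈pᵢ

∣p∣≡0⇒Empty : {p : Subset n} → ∣ p ∣ ≡ 0 → Empty p
∣p∣≡0⇒Empty {p = outside ∷ p} ∣p∣≡0 (_ , there x∈p) = ∣p∣≡0⇒Empty ∣p∣≡0 (_ , x∈p)
∣p∣≡0⇒Empty {p = inside  ∷ p} () _

Empty⇒∣p∣≡0 : {p : Subset n} → Empty p → ∣ p ∣ ≡ 0
Empty⇒∣p∣≡0 {n} p-empty = trans (cong ∣_∣ (Empty-unique p-empty)) (∣⊥∣≡0 n)

∣p∪q∣≤∣p∣+∣q∣ : (p q : Subset n) → ∣ p ∪ q ∣ ≤ ∣ p ∣ + ∣ q ∣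
∣p∪q∣≤∣p∣+∣q∣ []            []            = z≤n
∣p∪q∣≤∣p∣+∣q∣ (inside  ∷ p) (inside  ∷ q) = s≤s (≤-trans (∣p∪q∣≤∣p∣+∣q∣ p q) (+-monoʳ-≤ ∣ p ∣ (n≤1+n _)))
∣p∪q∣≤∣p∣+∣q∣ (inside  ∷ p) (outside ∷ q) = s≤s (∣p∪q∣≤∣p∣+∣q∣ p q)
∣p∪q∣≤∣p∣+∣q∣ (outside ∷ p) (inside  ∷ q) = ≤-trans (s≤s (∣p∪q∣≤∣p∣+∣q∣ p q)) (≤-reflexive (sym (+-suc _ _)))
∣p∪q∣≤∣p∣+∣q∣ (outside ∷ p) (outside ∷ q) = ∣p∪q∣≤∣p∣+∣q∣ p q

∣p∪q∣≡∣p∣+∣q∣ : (p q : Subset n) → Empty (p ∩ q) → ∣ p ∪ q ∣ ≡ ∣ p ∣ + ∣ q ∣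
∣p∪q∣≡∣p∣+∣q∣ []            []            _ = refl
∣p∪q∣≡∣p∣+∣q∣ (inside  ∷ p) (inside  ∷ q) p∩q-empty = ⊥-elim (p∩q-empty (zero , here))
∣p∪q∣≡∣p∣+∣q∣ (inside  ∷ p) (outside ∷ q) p∩q-empty = cong suc (∣p∪q∣≡∣p∣+∣q∣ p q (drop-∷-Empty p∩q-empty))
∣p∪q∣≡∣p∣+∣q∣ (outside ∷ p) (inside  ∷ q) p∩q-empty =
  trans (cong suc (∣p∪q∣≡∣p∣+∣q∣ p q (drop-∷-Empty p∩q-empty))) (sym (+-suc _ _))
∣p∪q∣≡∣p∣+∣q∣ (outside ∷ p) (outside ∷ q) p∩q-empty = ∣p∪q∣≡∣p∣+∣q∣ p q (drop-∷-Empty p∩q-empty)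

intermediate-subset : {X W : Subset n} {k : ℕ} → X ⊆ W → ∣ X ∣ ≤ k → k ≤ ∣ W ∣ →
  Σ[ S ∈ Subset n ] X ⊆ S × S ⊆ W × ∣ S ∣ ≡ k
intermediate-subset {X = []} {[]} {zero} _ _ _ = [] , (λ ()) , (λ ()) , refl
intermediate-subset {X = inside ∷ X} {outside ∷ W} X⊆W _ _ with X⊆W here
... | ()
intermediate-subset {X = outside ∷ X} {outside ∷ W} X⊆W ∣X∣≤k k≤∣W∣
  with intermediate-subset (drop-∷-⊆ X⊆W) ∣X∣≤k k≤∣W∣
... | S , X⊆S , S⊆W , ∣S∣≡k = outside ∷ S , out⊆ X⊆S , out⊆ S⊆W , ∣S∣≡k
intermediate-subset {X = inside ∷ X} {inside ∷ W} {suc k} X⊆W (s≤s ∣X∣≤k) (s≤s k≤∣W∣)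
  with intermediate-subset (drop-∷-⊆ X⊆W) ∣X∣≤k k≤∣W∣
... | S , X⊆S , S⊆W , ∣S∣≡k = inside ∷ S , in⊆in X⊆S , in⊆in S⊆W , cong suc ∣S∣≡k
intermediate-subset {X = outside ∷ X} {inside ∷ W} {k} X⊆W ∣X∣≤k k≤1+∣W∣ with k ≤? ∣ W ∣
... | yes k≤∣W∣ with intermediate-subset (drop-∷-⊆ X⊆W) ∣X∣≤k k≤∣W∣
...   | S , X⊆S , S⊆W , ∣S∣≡k = outside ∷ S , out⊆ X⊆S , out⊆ S⊆W , ∣S∣≡k
intermediate-subset {X = outside ∷ X} {inside ∷ W} {k} X⊆W ∣X∣≤k k≤1+∣W∣ | no k≰∣W∣ =
  inside ∷ W , out⊆ (drop-∷-⊆ X⊆W) , ⊆-refl , ≤-antisym (≰⇒> k≰∣W∣) k≤1+∣W∣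

Im : (Fin k → Fin n) → Subset n
Im f = ⋃ (λ i → ⁅ f i ⁆)

f∈Im : (f : Fin k → Fin n) (i : Fin k) → f i ∈ Im f
f∈Im f i = x∈⋃⁺ (λ j → ⁅ f j ⁆) i (x∈⁅x⁆ (f i))

x∈Im⁻ : (f : Fin k → Fin n) {x : Fin n} → x ∈ Im f → ∃ λ i → f i ≡ x
x∈Im⁻ f x∈ with x∈⋃⁻ (λ j → ⁅ f j ⁆) x∈
... | i , x∈⁅fi⁆ = i , sym (x∈⁅y⁆⇒x≡y _ x∈⁅fi⁆)

Im⊆ : (f : Fin k → Fin n) {p : Subset n} → (∀ i → f i ∈ p) → Im f ⊆ p
Im⊆ f fi∈p x∈ with x∈Im⁻ f x∈
... | i , refl = fi∈p i

Im⊆∁Im : (f : Fin k → Fin n) (h : Fin l → Fin n) → (∀ i j → f i ≢ h j) → Im f ⊆ ∁ (Im h)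
Im⊆∁Im f h f≢h {x} x∈Im-f = x∉p⇒x∈∁p x∉Im-h
  where
  x∉Im-h : x ∉ Im h
  x∉Im-h x∈Im-h with x∈Im⁻ f x∈Im-f | x∈Im⁻ h x∈Im-h
  ... | i , refl | j , hj≡fi = f≢h i j (sym hj≡fi)

∣Im∣≡ : (f : Fin k → Fin n) → Injective _≡_ _≡_ f → ∣ Im f ∣ ≡ k
∣Im∣≡ {zero}  {n} f _     = ∣⊥∣≡0 n
∣Im∣≡ {suc k}     f f-inj = begin
  ∣ ⁅ f zero ⁆ ∪ Im (f ∘ suc) ∣       ≡⟨ ∣p∪q∣≡∣p∣+∣q∣ _ _ disjoint ⟩
  ∣ ⁅ f zero ⁆ ∣ + ∣ Im (f ∘ suc) ∣  ≡⟨ cong₂ _+_ (∣⁅x⁆∣≡1 (f zero)) (∣Im∣≡ (f ∘ suc) (suc-injective ∘ f-inj)) ⟩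
  suc k                               ∎
  where
  open ≡-Reasoning
  disjoint : Empty (⁅ f zero ⁆ ∩ Im (f ∘ suc))
  disjoint (x , x∈) with x∈p∩q⁻ _ _ x∈
  ... | x∈⁅f0⁆ , x∈Im with x∈Im⁻ (f ∘ suc) x∈Im
  ...   | i , refl = 0≢1+n (f-inj (sym (x∈⁅y⁆⇒x≡y _ x∈⁅f0⁆)))

enum : (p : Subset n) → Fin ∣ p ∣ → Fin n
enum (inside  ∷ p) zero    = zero
enum (inside  ∷ p) (suc i) = suc (enum p i)
enum (outside ∷ p) i       = suc (enum p i)

enum-injective : (p : Subset n) → Injective _≡_ _≡_ (enum p)
enum-injective (inside  ∷ p) {zero}  {zero}  _  = refl
enum-injective (inside  ∷ p) {suc i} {suc j} eq = cong suc (enum-injective p (suc-injective eq))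
enum-injective (outside ∷ p)                 eq = enum-injective p (suc-injective eq)

enum∈ : (p : Subset n) (i : Fin ∣ p ∣) → enum p i ∈ p
enum∈ (inside  ∷ p) zero    = here
enum∈ (inside  ∷ p) (suc i) = there (enum∈ p i)
enum∈ (outside ∷ p) i       = there (enum∈ p i)

x∈p⇒x∈Im-enum : (p : Subset n) {x : Fin n} → x ∈ p → x ∈ Im (enum p)
x∈p⇒x∈Im-enum (inside  ∷ p) here       = f∈Im (enum (inside ∷ p)) zero
x∈p⇒x∈Im-enum (inside  ∷ p) (there x∈) with x∈Im⁻ (enum p) (x∈p⇒x∈Im-enum p x∈)
... | i , refl = f∈Im (enum (inside ∷ p)) (suc i)
x∈p⇒x∈Im-enum (outside ∷ p) (there x∈) with x∈Im⁻ (enum p) (x∈p⇒x∈Im-enum p x∈)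
... | i , refl = f∈Im (enum (outside ∷ p)) i

enumerate : (p : Subset n) → ∣ p ∣ ≡ k → Σ[ f ∈ (Fin k → Fin n) ] Injective _≡_ _≡_ f × Im f ≡ p
enumerate p refl = enum p , enum-injective p , ⊆-antisym (Im⊆ (enum p) (enum∈ p)) (x∈p⇒x∈Im-enum p)

++-injective : {f : Fin k → Fin n} {h : Fin l → Fin n} →
  Injective _≡_ _≡_ f → Injective _≡_ _≡_ h → (∀ i j → f i ≢ h j) → Injective _≡_ _≡_ (f ++ h)
++-injective {k} f-inj h-inj f≢h {x} {y} eq with splitAt k x in x≡ | splitAt k y in y≡
... | inj₁ i | inj₁ j = trans (sym (splitAt⁻¹-↑ˡ x≡)) (trans (cong (_↑ˡ _) (f-inj eq)) (splitAt⁻¹-↑ˡ y≡))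
... | inj₁ i | inj₂ j = ⊥-elim (f≢h i j eq)
... | inj₂ i | inj₁ j = ⊥-elim (f≢h j i (sym eq))
... | inj₂ i | inj₂ j = trans (sym (splitAt⁻¹-↑ʳ x≡)) (trans (cong (k ↑ʳ_) (h-inj eq)) (splitAt⁻¹-↑ʳ y≡))

↑ˡ≢↑ʳ : (i : Fin k) (j : Fin l) → i ↑ˡ l ≢ k ↑ʳ j
↑ˡ≢↑ʳ {k} {l} i j eq with trans (sym (splitAt-↑ˡ k i l)) (trans (cong (splitAt k) eq) (splitAt-↑ʳ k l j))
... | ()

supp⇒rowSupp : (M : Matrix m n) {r : Fin m} {c : Fin n} → r ∈ supp M c → c ∈ rowSupp M r
supp⇒rowSupp M {r} {c} r∈ = x∈tabulate⁺ (M r) (x∈tabulate⁻ (λ i → M i c) r∈)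

rowSupp⇒supp : (M : Matrix m n) {r : Fin m} {c : Fin n} → c ∈ rowSupp M r → r ∈ supp M c
rowSupp⇒supp M {r} {c} c∈ = x∈tabulate⁺ (λ i → M i c) (x∈tabulate⁻ (M r) c∈)

-- StronglyDisjunct d e v M says ∣ Separated M (cols ∘ (_↑ˡ d)) (cols ∘ (v ↑ʳ_)) ∣ > e.
Separated : Matrix m n → (Fin k → Fin n) → (Fin l → Fin n) → Subset m
Separated M f h = ⋂ (supp M ∘ f) ∩ ∁ (⋃ (supp M ∘ h))

∈Separated⁺ : (M : Matrix m n) (f : Fin k → Fin n) (h : Fin l → Fin n) {r : Fin m} →
  (∀ i → f i ∈ rowSupp M r) → (∀ j → h j ∉ rowSupp M r) → r ∈ Separated M f h
∈Separated⁺ M f h f⊆row h∉row = x∈p∩q⁺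
  ( x∈⋂⁺ (supp M ∘ f) (rowSupp⇒supp M ∘ f⊆row)
  , x∉p⇒x∈∁p λ r∈⋃ → let j , r∈supp = x∈⋃⁻ (supp M ∘ h) r∈⋃ in h∉row j (supp⇒rowSupp M r∈supp))

∈Separated⁻ : (M : Matrix m n) (f : Fin k → Fin n) (h : Fin l → Fin n) {r : Fin m} →
  r ∈ Separated M f h → (∀ i → f i ∈ rowSupp M r) × (∀ j → h j ∉ rowSupp M r)
∈Separated⁻ M f h r∈ with x∈p∩q⁻ _ _ r∈
... | r∈⋂ , r∈∁⋃ =
  (λ i → supp⇒rowSupp M (x∈⋂⁻ (supp M ∘ f) r∈⋂ i)) ,
  (λ j hj∈row → x∈∁p⇒x∉p r∈∁⋃ (x∈⋃⁺ (supp M ∘ h) j (rowSupp⇒supp M hj∈row)))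

module _ (u : ℕ) (M : Matrix m n) (S Z I : Subset n) {r : Fin m} where

  ∈goodRows⁺ : ∣ rowSupp M r ∩ S ∣ ≡ u → ∣ rowSupp M r ∩ Z ∣ ≡ 0 → I ⊆ rowSupp M r →
    r ∈ goodRows u M S Z I
  ∈goodRows⁺ onS offZ onI = x∈tabulate⁺ _ (Equivalence.to T-≡ (fromWitness (onS , offZ , λ {x} → onI {x})))

  ∈goodRows⁻ : r ∈ goodRows u M S Z I →
    ∣ rowSupp M r ∩ S ∣ ≡ u × ∣ rowSupp M r ∩ Z ∣ ≡ 0 × I ⊆ rowSupp M r
  ∈goodRows⁻ r∈ = toWitness (Equivalence.from T-≡ (x∈tabulate⁻ _ r∈))

≤∣∁p∣ : (p : Subset n) → ∣ p ∣ ≡ k → l + k ≤ n → l ≤ ∣ ∁ p ∣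
≤∣∁p∣ p refl l+∣p∣≤n = subst (_ ≤_) (sym (∣∁p∣≡n∸∣p∣ p)) (m+n≤o⇒m≤o∸n _ l+∣p∣≤n)

∣p∩q∪r∣≤2*d : {d : ℕ} (p q r : Subset n) → ∣ p ∣ ≤ d → ∣ r ∣ ≤ d → ∣ (p ∩ q) ∪ r ∣ ≤ 2 * d
∣p∩q∪r∣≤2*d {d = d} p q r ∣p∣≤d ∣r∣≤d = begin
  ∣ (p ∩ q) ∪ r ∣     ≤⟨ ∣p∪q∣≤∣p∣+∣q∣ (p ∩ q) r ⟩
  ∣ p ∩ q ∣ + ∣ r ∣   ≤⟨ +-mono-≤ (≤-trans (∣p∩q∣≤∣p∣ p q) ∣p∣≤d) ∣r∣≤d ⟩
  d + d               ≡⟨ cong (d +_) (sym (+-identityʳ d)) ⟩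
  2 * d               ∎
  where open ≤-Reasoning

p∩∁q∪r⊆∁q : {p q r : Subset n} → q ⊆ p → Empty (p ∩ r) → (p ∩ ∁ q) ∪ r ⊆ ∁ q
p∩∁q∪r⊆∁q {p = p} {q} {r} q⊆p p∩r-empty {x} x∈ with x∈p∪q⁻ (p ∩ ∁ q) r x∈
... | inj₁ x∈p∩∁q = proj₂ (x∈p∩q⁻ p (∁ q) x∈p∩∁q)
... | inj₂ x∈r    = x∉p⇒x∈∁p λ x∈q → p∩r-empty (x , x∈p∩q⁺ (q⊆p x∈q , x∈r))

separation⇒pattern : {U S Z D R : Subset n} → U ⊆ S → (S ∩ ∁ U) ∪ Z ⊆ D → U ⊆ R → Empty (R ∩ D) →
  R ∩ S ≡ U × Empty (R ∩ Z)
separation⇒pattern {U = U} {S} {Z} {D} {R} U⊆S S∖U∪Z⊆D U⊆R R∩D-empty =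
  ⊆-antisym R∩S⊆U (λ x∈U → x∈p∩q⁺ (U⊆R x∈U , U⊆S x∈U)) , R∩Z-empty
  where
  R∩S⊆U : R ∩ S ⊆ U
  R∩S⊆U {x} x∈ with x∈p∩q⁻ R S x∈ | x ∈? U
  ... | _         | yes x∈U = x∈U
  ... | x∈R , x∈S | no x∉U  =
    ⊥-elim (R∩D-empty (x , x∈p∩q⁺ (x∈R , S∖U∪Z⊆D (x∈p∪q⁺ (inj₁ (x∈p∩q⁺ (x∈S , x∉p⇒x∈∁p x∉U)))))))
  R∩Z-empty : Empty (R ∩ Z)
  R∩Z-empty (x , x∈) with x∈p∩q⁻ R Z x∈
  ... | x∈R , x∈Z = R∩D-empty (x , x∈p∩q⁺ (x∈R , S∖U∪Z⊆D (x∈p∪q⁺ (inj₂ x∈Z))))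

goodRows⊆Separated : (u : ℕ) (M : Matrix m n) (S : Subset n) (f : Fin k → Fin n) (h : Fin l → Fin n) →
  goodRows u M S (Im h) (Im f) ⊆ Separated M f h
goodRows⊆Separated u M S f h r∈ with ∈goodRows⁻ u M S (Im h) (Im f) r∈
... | _ , ∣row∩Im-h∣≡0 , Im-f⊆row =
  ∈Separated⁺ M f h (Im-f⊆row ∘ f∈Im f)
    (λ j hj∈row → ∣p∣≡0⇒Empty ∣row∩Im-h∣≡0 (h j , x∈p∩q⁺ (hj∈row , f∈Im h j)))

disjunct-separates : {M : Matrix m n} {d e u g : ℕ} → g < u → u ≤ d → d + d ≤ n → Disjunct d e u g M →
  (f : Fin (suc g) → Fin n) (h : Fin d → Fin n) →
  Injective _≡_ _≡_ f → Injective _≡_ _≡_ h → (∀ i j → f i ≢ h j) → e < ∣ Separated M f h ∣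
disjunct-separates {M = M} {d} {u = u} g<u u≤d 2d≤n disjunct f h f-inj h-inj f≢h
  with intermediate-subset (Im⊆∁Im f h f≢h)
         (≤-trans (≤-reflexive (∣Im∣≡ f f-inj)) (≤-trans g<u u≤d)) (≤∣∁p∣ (Im h) (∣Im∣≡ h h-inj) 2d≤n)
... | S , Im-f⊆S , S⊆∁Im-h , ∣S∣≡d =
  ≤-trans
    (disjunct S (Im h) (≤-trans u≤d (≤-reflexive (sym ∣S∣≡d))) (≤-reflexive ∣S∣≡d)
      (≤-reflexive (trans (∣Im∣≡ h h-inj) (sym ∣S∣≡d))) S∩Im-h-empty
      (Im f) Im-f⊆S (∣Im∣≡ f f-inj))
    (p⊆q⇒∣p∣≤∣q∣ (goodRows⊆Separated u M S f h))
  where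
  S∩Im-h-empty : Empty (S ∩ Im h)
  S∩Im-h-empty (x , x∈) with x∈p∩q⁻ S (Im h) x∈
  ... | x∈S , x∈Im-h = x∈∁p⇒x∉p (S⊆∁Im-h x∈S) x∈Im-h

stronglyDisjunct-separates : {M : Matrix m n} {d e v : ℕ} → StronglyDisjunct d e v M →
  {U D : Subset n} → ∣ U ∣ ≡ v → ∣ D ∣ ≡ d → D ⊆ ∁ U →
  Σ[ T ∈ Subset m ] e < ∣ T ∣ × (∀ {r} → r ∈ T → U ⊆ rowSupp M r × Empty (rowSupp M r ∩ D))
stronglyDisjunct-separates {M = M} {d} {v = v} (_ , separated-large) {U} {D} ∣U∣≡v ∣D∣≡d D⊆∁U
  with enumerate U ∣U∣≡v | enumerate D ∣D∣≡d
... | f , f-inj , refl | h , h-inj , refl =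
  Separated M ((f ++ h) ∘ (_↑ˡ d)) ((f ++ h) ∘ (v ↑ʳ_)) ,
  separated-large (f ++ h) (++-injective f-inj h-inj f≢h) ,
  separation
  where
  f≢h : ∀ i j → f i ≢ h j
  f≢h i j fi≡hj = x∈∁p⇒x∉p (D⊆∁U (f∈Im h j)) (subst (_∈ Im f) fi≡hj (f∈Im f i))
  separation : ∀ {r} → r ∈ Separated M ((f ++ h) ∘ (_↑ˡ d)) ((f ++ h) ∘ (v ↑ʳ_)) →
    Im f ⊆ rowSupp M r × Empty (rowSupp M r ∩ Im h)
  separation {r} r∈ with ∈Separated⁻ M _ _ r∈
  ... | ones , zeros = Im⊆ f (λ i → subst (_∈ rowSupp M r) (lookup-++ˡ f h i) (ones i)) , row∩Im-h-empty
    where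
    row∩Im-h-empty : Empty (rowSupp M r ∩ Im h)
    row∩Im-h-empty (x , x∈) with x∈p∩q⁻ (rowSupp M r) (Im h) x∈
    ... | x∈row , x∈Im-h with x∈Im⁻ h x∈Im-h
    ...   | j , refl = zeros j (subst (_∈ rowSupp M r) (sym (lookup-++ʳ f h j)) x∈row)

disjunct⇒stronglyDisjunct : {M : Matrix m n} {d e u g : ℕ} → g < u → u ≤ d → d + (d + g + 1) ≤ n →
  Disjunct d e u g M → StronglyDisjunct d e (suc g) M
disjunct⇒stronglyDisjunct {n = n} {M = M} {d} {e} {u} {g} g<u u≤d n-bound disjunct =
  d+1+g≤n ,
  λ cols cols-inj → disjunct-separates {M = M} {d} {e} {u} g<u u≤d 2d≤n disjunct (cols ∘ (_↑ˡ d)) (cols ∘ (suc g ↑ʳ_))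
    (↑ˡ-injective d _ _ ∘ cols-inj) (↑ʳ-injective (suc g) _ _ ∘ cols-inj) (λ i j → ↑ˡ≢↑ʳ i j ∘ cols-inj)
  where
  d+1+g≤n : d + suc g ≤ n
  d+1+g≤n = ≤-trans (+-monoʳ-≤ d (≤-trans (s≤s (m≤n+m g d)) (≤-reflexive (+-comm 1 (d + g))))) n-bound
  2d≤n : d + d ≤ n
  2d≤n = ≤-trans (+-monoʳ-≤ d (≤-trans (m≤m+n d g) (m≤m+n (d + g) 1))) n-bound

stronglyDisjunct⇒disjunct : {M : Matrix m n} {d e u g : ℕ} → g < u →
  StronglyDisjunct (2 * d) e u M → Disjunct d e u g M
stronglyDisjunct⇒disjunct {M = M} {d} {e} {u} g<u strongly@(2d+u≤n , _)
  S Z u≤∣S∣ ∣S∣≤d ∣Z∣≤∣S∣ S∩Z-empty I I⊆S ∣I∣≡1+g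
  with intermediate-subset I⊆S (≤-trans (≤-reflexive ∣I∣≡1+g) g<u) u≤∣S∣
... | U , I⊆U , U⊆S , ∣U∣≡u
  with intermediate-subset (p∩∁q∪r⊆∁q U⊆S S∩Z-empty) (∣p∩q∪r∣≤2*d S (∁ U) Z ∣S∣≤d (≤-trans ∣Z∣≤∣S∣ ∣S∣≤d))
         (≤∣∁p∣ U ∣U∣≡u 2d+u≤n)
... | D , S∖U∪Z⊆D , D⊆∁U , ∣D∣≡2d
  with stronglyDisjunct-separates {M = M} strongly ∣U∣≡u ∣D∣≡2d D⊆∁U
... | T , e<∣T∣ , T-separates = ≤-trans e<∣T∣ (p⊆q⇒∣p∣≤∣q∣ T⊆goodRows)
  where
  T⊆goodRows : T ⊆ goodRows u M S Z I
  T⊆goodRows r∈T with T-separates r∈T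
  ... | U⊆row , row∩D-empty with separation⇒pattern U⊆S S∖U∪Z⊆D U⊆row row∩D-empty
  ...   | row∩S≡U , row∩Z-empty =
    ∈goodRows⁺ u M S Z I (trans (cong ∣_∣ row∩S≡U) ∣U∣≡u) (Empty⇒∣p∣≡0 row∩Z-empty) (⊆-trans I⊆U U⊆row)

proposition15 : (m n d e u g : ℕ) → g < u → u ≤ d → d + (d + g + 1) ≤ n →
    (M M′ : Matrix m n) → Disjunct d e u g M → StronglyDisjunct (2 * d) e u M′ →
    StronglyDisjunct d e (suc g) M × Disjunct d e u g M′
proposition15 m n d e u g g<u u≤d n-bound M M′ M-disjunct M′-strongly =
  disjunct⇒stronglyDisjunct {M = M} {d} {e} g<u u≤d n-bound M-disjunct ,
  stronglyDisjunct⇒disjunct {M = M′} {d} {e} g<u M′-strongly
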